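{- Let $\mathcal T$ be a perfect topology on a non-empty set $U$. Suppose $X\subseteq U$ is such that for every $V\in\mathcal T$, the set $X\cap V$ is either empty or infinite. Then $\mathcal T\cup\{V\cap X: V\in\mathcal T\}$ is a basis of a perfect topology $\mathcal T'\supseteq\mathcal T$ with $X\in\mathcal T'$. Consequently, $\mathcal T$ is a maximal perfect topology if and only if every $X\subseteq U$ such that $X\cap V$ is empty or infinite for every $V\in\mathcal T$ belongs to $\mathcal T$. Moreover, if $\mathcal T$ is a maximal perfect Hausdorff topology, then every discrete subset of $U$ is closed.
   Context: A topology is \emph{perfect} if every non-empty open set is infinite. A perfect topology $\mathcal T$ on $U$ is a \emph{maximal perfect topology} if no topology on $U$ strictly finer than $\mathcal T$ is perfect. A set $C\subseteq U$ is \emph{discrete} if for every $x\in C$ there is $V\in\mathcal T$ with $V\cap C=\{x\}$. -}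

module Defs where

open import Level using (0ℓ)
open import Data.Nat using (ℕ)
open import Data.Fin using (Fin)
open import Data.Product using (Σ; ∃; _×_; _,_)
open import Data.Sum using (_⊎_)
open import Data.Empty using (⊥)
open import Relation.Nullary using (¬_)
open import Relation.Binary.PropositionalEquality using (_≡_; _≢_)

Subset : Set → Set₁
Subset U = U → Set

Family : Set → Set₁
Family U = Subset U → Set

module _ {U : Set} where

  _∈_ : U → Subset U → Set
  x ∈ A = A x

  _⊆_ : Subset U → Subset U → Set
  A ⊆ B = ∀ x → A x → B x

  _≐_ : Subset U → Subset U → Set
  A ≐ B = (A ⊆ B) × (B ⊆ A)

  _∩_ : Subset U → Subset U → Subset U
  (A ∩ B) x = A x × B x

  ∅ : Subset U
  ∅ _ = ⊥

  Full : Subset U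
  Full _ = U

  ∁ : Subset U → Subset U
  ∁ A x = ¬ A x

  ⋃ : {I : Set} → (I → Subset U) → Subset U
  ⋃ {I} F x = Σ I λ i → F i x

  _⊑_ : Family U → Family U → Set₁
  𝒜 ⊑ ℬ = ∀ A → 𝒜 A → ℬ A

  Empty : Subset U → Set
  Empty A = ∀ x → ¬ A x

  NonEmpty : Subset U → Set
  NonEmpty A = Σ U λ x → A x

  Finite : Subset U → Set
  Finite A = Σ ℕ λ n → Σ (Fin n → U) λ f → ∀ x → A x → Σ (Fin n) λ i → f i ≡ x

  Infinite : Subset U → Set
  Infinite A = ¬ Finite A

  record IsTopology (T : Family U) : Set₁ where
    field
      ext      : ∀ A B → A ≐ B → T A → T B
      empty    : T ∅
      full     : T Full
      inter    : ∀ A B → T A → T B → T (A ∩ B)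
      unions   : (I : Set) (F : I → Subset U) → (∀ i → T (F i)) → T (⋃ F)

  Perfect : Family U → Set₁
  Perfect T = ∀ V → T V → NonEmpty V → Infinite V

  MaximalPerfect : Family U → Set₁
  MaximalPerfect T =
    Perfect T ×
    ¬ (Σ (Family U) λ T' → IsTopology T' × Perfect T' × (T ⊑ T') × ¬ (T' ⊑ T))

  -- B is a basis of the topology T'.
  -- (the basis may be a large family, hence Subset U → Set₁)
  IsBasisOf : (Subset U → Set₁) → Family U → Set₁
  IsBasisOf B T' =
    (∀ W → B W → T' W) ×
    (∀ V → T' V → ∀ x → V x → Σ (Subset U) λ W → B W × W x × (W ⊆ V))

  EmptyOrInfiniteMeets : Family U → Subset U → Set₁
  EmptyOrInfiniteMeets T X = ∀ V → T V → Empty (X ∩ V) ⊎ Infinite (X ∩ V)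

  Extended : Family U → Subset U → Subset U → Set₁
  Extended T X W = T W ⊎ (Σ (Subset U) λ V → T V × (W ≐ (V ∩ X)))

  Hausdorff : Family U → Set₁
  Hausdorff T = ∀ x y → x ≢ y →
    Σ (Subset U) λ V → Σ (Subset U) λ W →
      T V × T W × V x × W y × Empty (V ∩ W)

  Discrete : Family U → Subset U → Set₁
  Discrete T C = ∀ x → C x →
    Σ (Subset U) λ V → T V × (∀ y → (V y × C y → y ≡ x) × (y ≡ x → V y × C y))

  Closed : Family U → Subset U → Set
  Closed T C = T (∁ C)

{-# OPTIONS --safe #-}
-- Sets which meet every open set in ∅ or in an infinite set can be adjoined
-- as open: a basic open set of the extension is V or V ∩ X with V open, and
-- a non-empty V ∩ X is infinite by hypothesis.  Conversely every open set of
-- a finer perfect topology has this property, which gives the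
-- characterisation of maximality.  The complement of a discrete set C has it
-- as well: if an open V meets C in z, isolated in C by O, then O ∩ V is a
-- non-empty open set covered by z and ∁ C ∩ V, so ∁ C ∩ V cannot be finite.
module Submission where

open import Defs
open import Level using (0ℓ)
open import Axiom.ExcludedMiddle using (ExcludedMiddle)
open import Data.Product using (Σ; _×_; _,_; proj₁; proj₂)
open import Data.Sum using (_⊎_; inj₁; inj₂; [_,_])
open import Data.Bool using (Bool; true)
open import Data.Nat using (suc)
open import Data.Fin using (Fin; zero; suc)
open import Data.Empty using (⊥; ⊥-elim)
open import Relation.Nullary using (yes; no; does)
open import Relation.Binary.PropositionalEquality using (_≡_; refl; sym)
open import Function.Bundles using (_⇔_; mk⇔; Equivalence)

module _ {U : Set} where

  finite-⊆ : {A B : Subset U} → A ⊆ B → Finite B → Finite A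
  finite-⊆ A⊆B (n , f , cover) = n , f , λ x a → cover x (A⊆B x a)

  infinite-⊆ : {A B : Subset U} → A ⊆ B → Infinite A → Infinite B
  infinite-⊆ A⊆B infA finB = infA (finite-⊆ A⊆B finB)

  finite-insert : {A B : Subset U} (z : U) → (∀ y → A y → y ≡ z ⊎ B y) →
                  Finite B → Finite A
  finite-insert {A} z A⊆z∷B (n , f , cover) = suc n , g , cover′
    where
      g : Fin (suc n) → U
      g zero    = z
      g (suc i) = f i
      cover′ : ∀ y → A y → Σ (Fin (suc n)) λ i → g i ≡ y
      cover′ y a with A⊆z∷B y a
      ... | inj₁ y≡z = zero , sym y≡z
      ... | inj₂ b with cover y b
      ...   | i , fi≡y = suc i , fi≡y

module _ (em : ExcludedMiddle 0ℓ) {U : Set} where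

  -- The extended topology must be a Family U, i.e. quantify only over small
  -- sets, so open neighbourhoods are coded by their characteristic functions.
  χ : Subset U → U → Bool
  χ A x = does (em {A x})

  ⟦_⟧ : (U → Bool) → Subset U
  ⟦ b ⟧ x = b x ≡ true

  ⟦χ⟧-⊆ : (A : Subset U) → ⟦ χ A ⟧ ⊆ A
  ⟦χ⟧-⊆ A x with em {A x}
  ... | yes a = λ _ → a
  ... | no _  = λ ()

  ⊆-⟦χ⟧ : (A : Subset U) → A ⊆ ⟦ χ A ⟧
  ⊆-⟦χ⟧ A x a with em {A x}
  ... | yes _  = refl
  ... | no ¬a = ⊥-elim (¬a a)

  module Extension (T : Family U) (topT : IsTopology T) (X : Subset U) where
    open IsTopology

    -- V is a basic neighbourhood of x inside W: the basic set is V ∩ X when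
    -- the right alternative is taken, and V itself otherwise.
    Inside : U → Subset U → Subset U → Set
    Inside x V W = (V ⊆ W) ⊎ (X x × ((V ∩ X) ⊆ W))

    Inside-⊆ : ∀ {x V W W′} → W ⊆ W′ → Inside x V W → Inside x V W′
    Inside-⊆ W⊆W′ (inj₁ V⊆W)      = inj₁ λ y v → W⊆W′ y (V⊆W y v)
    Inside-⊆ W⊆W′ (inj₂ (x∈X , s)) = inj₂ (x∈X , λ y v → W⊆W′ y (s y v))

    Inside-⊇ : ∀ {x V V′ W} → V′ ⊆ V → Inside x V W → Inside x V′ W
    Inside-⊇ V′⊆V (inj₁ V⊆W)      = inj₁ λ y v → V⊆W y (V′⊆V y v)
    Inside-⊇ V′⊆V (inj₂ (x∈X , s)) = inj₂ (x∈X , λ y (v , xy) → s y (V′⊆V y v , xy))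

    Inside-∩ : ∀ {x V₁ V₂ W₁ W₂} → Inside x V₁ W₁ → Inside x V₂ W₂ →
               Inside x (V₁ ∩ V₂) (W₁ ∩ W₂)
    Inside-∩ (inj₁ s) (inj₁ t) = inj₁ λ y (v₁ , v₂) → s y v₁ , t y v₂
    Inside-∩ (inj₁ s) (inj₂ (x∈X , t)) =
      inj₂ (x∈X , λ y ((v₁ , v₂) , xy) → s y v₁ , t y (v₂ , xy))
    Inside-∩ (inj₂ (x∈X , s)) t =
      inj₂ (x∈X , λ y ((v₁ , v₂) , xy) →
        s y (v₁ , xy) , [ (λ t → t y v₂) , (λ (_ , t) → t y (v₂ , xy)) ] t)

    Neighbourhood : Subset U → U → Subset U → Set
    Neighbourhood W x V = T V × V x × Inside x V W

    T⁺ : Family U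
    T⁺ W = ∀ x → W x → Σ (U → Bool) λ b → Neighbourhood W x ⟦ b ⟧

    code : ∀ {W x} V → Neighbourhood W x V → Σ (U → Bool) λ b → Neighbourhood W x ⟦ b ⟧
    code V (TV , Vx , inside) =
      χ V , ext topT V _ (⊆-⟦χ⟧ V , ⟦χ⟧-⊆ V) TV , ⊆-⟦χ⟧ V _ Vx , Inside-⊇ (⟦χ⟧-⊆ V) inside

    T⁺-isTopology : IsTopology T⁺
    ext    T⁺-isTopology A B (A⊆B , B⊆A) T⁺A x Bx with T⁺A x (B⊆A x Bx)
    ... | b , TV , Vx , inside = b , TV , Vx , Inside-⊆ A⊆B inside
    empty  T⁺-isTopology x ()
    full   T⁺-isTopology x _ = code Full (full topT , x , inj₁ λ _ y → y)
    inter  T⁺-isTopology A B T⁺A T⁺B x (Ax , Bx) with T⁺A x Ax | T⁺B x Bx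
    ... | b₁ , TV₁ , V₁x , inside₁ | b₂ , TV₂ , V₂x , inside₂ =
      code (⟦ b₁ ⟧ ∩ ⟦ b₂ ⟧) (inter topT _ _ TV₁ TV₂ , (V₁x , V₂x) , Inside-∩ inside₁ inside₂)
    unions T⁺-isTopology I F T⁺F x (i , Fix) with T⁺F i x Fix
    ... | b , TV , Vx , inside = b , TV , Vx , Inside-⊆ (λ y Fiy → i , Fiy) inside

    T⊑T⁺ : T ⊑ T⁺
    T⊑T⁺ V TV x Vx = code V (TV , Vx , inj₁ λ _ y → y)

    T⁺X : T⁺ X
    T⁺X x Xx = code Full (full topT , x , inj₂ (Xx , λ _ → proj₂))

    Extended-isBasisOf-T⁺ : IsBasisOf (Extended T X) T⁺
    Extended-isBasisOf-T⁺ = Extended⊑T⁺ , T⁺-covered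
      where
        Extended⊑T⁺ : ∀ W → Extended T X W → T⁺ W
        Extended⊑T⁺ W (inj₁ TW) = T⊑T⁺ W TW
        Extended⊑T⁺ W (inj₂ (V , TV , (W⊆V∩X , V∩X⊆W))) x Wx =
          code V (TV , proj₁ (W⊆V∩X x Wx) , inj₂ (proj₂ (W⊆V∩X x Wx) , V∩X⊆W))
        T⁺-covered : ∀ W → T⁺ W → ∀ x → W x →
                     Σ (Subset U) λ B → Extended T X B × B x × (B ⊆ W)
        T⁺-covered W T⁺W x Wx with T⁺W x Wx
        ... | b , TV , Vx , inj₁ V⊆W = ⟦ b ⟧ , inj₁ TV , Vx , V⊆W
        ... | b , TV , Vx , inj₂ (Xx , V∩X⊆W) =
          ⟦ b ⟧ ∩ X , inj₂ (⟦ b ⟧ , TV , ((λ _ p → p) , (λ _ p → p))) , (Vx , Xx) , V∩X⊆W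

    T⁺-perfect : Perfect T → EmptyOrInfiniteMeets T X → Perfect T⁺
    T⁺-perfect perfT meetsX W T⁺W (x , Wx) with T⁺W x Wx
    ... | b , TV , Vx , inj₁ V⊆W = infinite-⊆ V⊆W (perfT ⟦ b ⟧ TV (x , Vx))
    ... | b , TV , Vx , inj₂ (Xx , V∩X⊆W) with meetsX ⟦ b ⟧ TV
    ...   | inj₁ X∩V-empty = ⊥-elim (X∩V-empty x (Xx , Vx))
    ...   | inj₂ X∩V-infinite =
      infinite-⊆ (λ y (Xy , Vy) → V∩X⊆W y (Vy , Xy)) X∩V-infinite

  extension : (T : Family U) → IsTopology T → Perfect T →
              (X : Subset U) → EmptyOrInfiniteMeets T X →
              Σ (Family U) λ T′ → IsTopology T′ × Perfect T′ × (T ⊑ T′) × T′ X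
                × IsBasisOf (Extended T X) T′
  extension T topT perfT X meetsX =
    T⁺ , T⁺-isTopology , T⁺-perfect perfT meetsX , T⊑T⁺ , T⁺X , Extended-isBasisOf-T⁺
    where open Extension T topT X

  finer-perfect⇒emptyOrInfiniteMeets :
    {T T′ : Family U} → IsTopology T′ → Perfect T′ → T ⊑ T′ →
    ∀ A → T′ A → EmptyOrInfiniteMeets T A
  finer-perfect⇒emptyOrInfiniteMeets {T′ = T′} topT′ perfT′ T⊑T′ A T′A V TV
    with em {NonEmpty (A ∩ V)}
  ... | yes A∩V≠∅ = inj₂ (perfT′ (A ∩ V) (inter A V T′A (T⊑T′ V TV)) A∩V≠∅)
    where open IsTopology topT′
  ... | no  A∩V=∅ = inj₁ λ x p → A∩V=∅ (x , p)

  maximalPerfect⇔ : (T : Family U) → IsTopology T → Perfect T →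
    MaximalPerfect T ⇔ ((X : Subset U) → EmptyOrInfiniteMeets T X → T X)
  maximalPerfect⇔ T topT perfT = mk⇔ maximal⇒ ⇒maximal
    where
      maximal⇒ : MaximalPerfect T → (X : Subset U) → EmptyOrInfiniteMeets T X → T X
      maximal⇒ (_ , noFiner) X meetsX with em {T X}
      ... | yes TX = TX
      ... | no ¬TX with extension T topT perfT X meetsX
      ...   | T′ , topT′ , perfT′ , T⊑T′ , T′X , _ =
        ⊥-elim (noFiner (T′ , topT′ , perfT′ , T⊑T′ , λ T′⊑T → ¬TX (T′⊑T X T′X)))
      ⇒maximal : ((X : Subset U) → EmptyOrInfiniteMeets T X → T X) → MaximalPerfect T
      ⇒maximal closed = perfT , λ (T′ , topT′ , perfT′ , T⊑T′ , T′⋢T) →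
        T′⋢T λ A T′A → closed A
          (finer-perfect⇒emptyOrInfiniteMeets topT′ perfT′ T⊑T′ A T′A)

  discrete⇒∁-emptyOrInfiniteMeets : (T : Family U) → IsTopology T → Perfect T →
    (C : Subset U) → Discrete T C → EmptyOrInfiniteMeets T (∁ C)
  discrete⇒∁-emptyOrInfiniteMeets T topT perfT C discC V TV
    with em {NonEmpty (∁ C ∩ V)}
  ... | no ∁C∩V=∅ = inj₁ λ x p → ∁C∩V=∅ (x , p)
  ... | yes (x , ∁C∩V-x) = inj₂ λ finite → not-finite finite
    where
      open IsTopology topT
      not-finite : Finite (∁ C ∩ V) → ⊥
      not-finite finite with em {Σ U λ z → C z × V z}
      ... | no V⊆∁C =
        perfT V TV (x , proj₂ ∁C∩V-x)
          (finite-⊆ (λ y Vy → (λ Cy → V⊆∁C (y , Cy , Vy)) , Vy) finite)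
      ... | yes (z , Cz , Vz) with discC z Cz
      ...   | O , TO , isolates =
        perfT (O ∩ V) (inter O V TO TV) (z , proj₁ (proj₂ (isolates z) refl) , Vz)
          (finite-insert z O∩V⊆z∷∁C∩V finite)
        where
          O∩V⊆z∷∁C∩V : ∀ y → (O ∩ V) y → y ≡ z ⊎ (∁ C ∩ V) y
          O∩V⊆z∷∁C∩V y (Oy , Vy) with em {C y}
          ... | yes Cy  = inj₁ (proj₁ (isolates y) (Oy , Cy))
          ... | no ¬Cy = inj₂ (¬Cy , Vy)

  maximalPerfect⇒discrete-closed : (T : Family U) → IsTopology T → Perfect T →
    MaximalPerfect T → (C : Subset U) → Discrete T C → Closed T C
  maximalPerfect⇒discrete-closed T topT perfT maximal C discC =
    Equivalence.to (maximalPerfect⇔ T topT perfT) maximal (∁ C)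
      (discrete⇒∁-emptyOrInfiniteMeets T topT perfT C discC)

mainTheorem5 : ExcludedMiddle 0ℓ →
    (U : Set) → U → (T : Family U) → IsTopology T → Perfect T →
      ((X : Subset U) → EmptyOrInfiniteMeets T X →
        Σ (Family U) λ T' → IsTopology T' × Perfect T' × (T ⊑ T') × T' X
          × IsBasisOf (Extended T X) T')
      × (MaximalPerfect T ⇔ ((X : Subset U) → EmptyOrInfiniteMeets T X → T X))
      × (MaximalPerfect T → Hausdorff T → (C : Subset U) → Discrete T C → Closed T C)
mainTheorem5 em U _ T topT perfT =
  extension em T topT perfT ,
  maximalPerfect⇔ em T topT perfT ,
  λ maximal _ → maximalPerfect⇒discrete-closed em T topT perfT maximal
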